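{- Let $n,m\geq1$, $\vec{x},\vec{y}\in\widehat{\mathbb{N}}^n$ and $\vec{a},\vec{b}\in\widehat{\mathbb{N}}^m$. Then $\vec{x}\,\tilde{\ltimes}\,\vec{a}<\vec{x}\,\tilde{\ltimes}\,\vec{b}$ if and only if $\vec{a}<\vec{b}$, and $\vec{x}\,\tilde{\ltimes}\,\vec{a}<\vec{y}\,\tilde{\ltimes}\,\vec{a}$ if and only if $\vec{x}<\vec{y}$.
   Context: $Y_n$ is the set of planar rooted binary trees with $n$ internal vertices, identified with complete parenthesizations of $x_1\cdots x_{n+1}$. The name of $\tau\in Y_n$ ($n\ge1$) is $(v_1,\ldots,v_n)$: $v_i=i$ if $x_i$ is immediately preceded by a left parenthesis; otherwise $x_i$ is immediately followed by a nonempty block of right parentheses and $v_i=j$ where $x_j$ is the first variable after the left parenthesis matched with the last right parenthesis of that block. The one-leaf tree has name $(0)$. $\widehat{\mathbb{N}}^n$ is the set of names of trees in $Y_n$, ordered componentwise; $<$ means $\le$ and $\ne$. For $\vec v\in\widehat{\mathbb{N}}^n,\vec w\in\widehat{\mathbb{N}}^m$ ($n,m\ge1$): $\vec v\nearrow\vec w:=(\vec v,n\triangleright\vec w)$, $\vec v\nwarrow\vec w:=(\vec v,w_1+n,\ldots,w_m+n)$, where $n\triangleright\vec w:=(n\tilde+w_1,\ldots,n\tilde+w_m)$, $n\tilde+1:=1$, $n\tilde+a:=n+a$ ($a\neq1$); $(0)$ is declared a two-sided unit for $\nearrow$ and $\nwarrow$. These operations are associative and satisfy $(\vec u\nearrow\vec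 v)\nwarrow\vec w=\vec u\nearrow(\vec v\nwarrow\vec w)$. Every name $\vec v\in\widehat{\mathbb{N}}^n$, $n\ge1$, is uniquely the name of a grafting $\tau_l\vee\tau_r$ (root of $\tau_l$ on the left leaf, root of $\tau_r$ on the right leaf of the one-vertex tree), and we write $\vec v=\vec v_l\vee\vec v_r$ with $\vec v_l,\vec v_r$ the names of $\tau_l,\tau_r$ (possibly $(0)$). Define recursively, for $\vec a\in\widehat{\mathbb{N}}^m$, $\varpi_{(0)}(\vec a):=(0)$ and $\varpi_{\vec v}(\vec a):=\varpi_{\vec v_l}(\vec a)\nearrow\vec a\nwarrow\varpi_{\vec v_r}(\vec a)$, and set $\vec x\,\tilde\ltimes\,\vec a:=\varpi_{\vec x}(\vec a)\in\widehat{\mathbb{N}}^{nm}$. -}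

module Defs where

open import Data.Nat using (ℕ; zero; suc; _+_; _≤_)
open import Data.List using (List; []; _∷_; _++_; map; length; [_])
open import Data.List.Relation.Binary.Pointwise using (Pointwise)
open import Data.Product using (_×_)
open import Relation.Binary.PropositionalEquality using (_≡_)
open import Relation.Nullary using (¬_)

-- Planar rooted binary trees; `node l r` is the grafting l ∨ r.
data Tree : Set where
  leaf : Tree
  node : Tree → Tree → Tree

-- number of internal vertices (τ ∈ Y_n iff internal τ ≡ n)
internal : Tree → ℕ
internal leaf       = 0
internal (node l r) = suc (internal l + internal r)

leaves : Tree → ℕ
leaves leaf       = 1
leaves (node l r) = leaves l + leaves r

-- The entries v_1..v_{leaves-1} of the name (empty for the one-leaf tree).
-- For τ = l ∨ r with p = leaves l, written (L R):  the variables of L keep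
-- their values except x_p, the last variable of l, which gets 1 (it is either
-- x_1 preceded by '(' or it closes l whose first variable is x_1); the
-- variables of R, except the very last one, get their value in r shifted by p.
name' : Tree → List ℕ
name' leaf       = []
name' (node l r) = name' l ++ (1 ∷ map (leaves l +_) (name' r))

name : Tree → List ℕ
name leaf         = 0 ∷ []
name t@(node _ _) = name' t

_~+_ : ℕ → ℕ → ℕ
n ~+ 1 = 1
n ~+ a = n + a

_↗_ : List ℕ → List ℕ → List ℕ
(0 ∷ []) ↗ w        = w
v ↗ (0 ∷ [])        = v
v ↗ w               = v ++ map (length v ~+_) w

_↖_ : List ℕ → List ℕ → List ℕ
(0 ∷ []) ↖ w        = w
v ↖ (0 ∷ [])        = v
v ↖ w               = v ++ map (length v +_) w

infixl 6 _↗_ _↖_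

ϖ : Tree → List ℕ → List ℕ
ϖ leaf       a = 0 ∷ []
ϖ (node l r) a = (ϖ l a ↗ a) ↖ ϖ r a

-- x ⋉̃ a := ϖ_x(a), where x is given by its (unique) tree
_⋉̃_ : Tree → List ℕ → List ℕ
x ⋉̃ a = ϖ x a

_≤ₙ_ : List ℕ → List ℕ → Set
v ≤ₙ w = Pointwise _≤_ v w

_<ₙ_ : List ℕ → List ℕ → Set
v <ₙ w = (v ≤ₙ w) × ¬ (v ≡ w)

{-# OPTIONS --safe #-}
-- When neither x nor a is the one-leaf tree, the units of ↗ and ↖ never fire and
-- x ⋉̃ a is the concatenation of n blocks of length m, one per internal vertex of x
-- in left-to-right order.  Recursively, ϖ_{l ∨ r}(a) is ϖ_l(a), then |l|m ▷ a, then
-- ϖ_r(a) shifted by (|l| + 1)m; each piece is monotone in a, and the leftmost block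
-- is a itself, which gives the first equivalence.  In terms of the name x₁ … xₙ,
-- block k sends an entry j ≠ 1 of a to (k − 1)m + j and an entry 1 to (xₖ − 1)m + 1.
-- Every block is monotone in xₖ, and since a starts with 1, xₖ can be read off the
-- first entry of block k; this gives the second equivalence.
module Submission where

open import Defs
open import Data.Nat using (ℕ; zero; suc; _+_; _*_; _≤_; z≤n; s≤s; s≤s⁻¹; pred)
open import Data.Nat.Properties
open import Data.Nat.Tactic.RingSolver using (solve-∀)
open import Data.List using (List; []; _∷_; _++_; map; length)
open import Data.List.Properties using (length-++; length-map; map-++; map-cong; map-∘; ++-assoc; ++-identityʳ; map-id-local)
open import Data.List.Relation.Binary.Pointwise as Pointwise using (Pointwise; []; _∷_)
import Data.List.Relation.Binary.Pointwise.Properties as Pointwiseₚ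
open import Data.List.Relation.Unary.All as All using (All; []; _∷_)
import Data.List.Relation.Unary.All.Properties as Allₚ
open import Data.Product as Product using (_×_; _,_; ∃; proj₁; proj₂)
open import Function.Bundles using (_⇔_; mk⇔; Equivalence)
open import Relation.Binary.PropositionalEquality
open ≡-Reasoning

Pointwise-++⁻ : ∀ {A : Set} {R : A → A → Set} xs ys {zs ws} → length xs ≡ length ys →
                Pointwise R (xs ++ zs) (ys ++ ws) → Pointwise R xs ys × Pointwise R zs ws
Pointwise-++⁻ []       []       _   rs       = [] , rs
Pointwise-++⁻ (x ∷ xs) (y ∷ ys) len (r ∷ rs) = Product.map₁ (r ∷_) (Pointwise-++⁻ xs ys (suc-injective len) rs)

≤ₙ-antisym : ∀ {v w} → v ≤ₙ w → w ≤ₙ v → v ≡ w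
≤ₙ-antisym p q = Pointwise.Pointwise-≡⇒≡ (Pointwiseₚ.antisymmetric ≤-antisym p q)

strict-⇔ : ∀ {v w v′ w′} → (v ≤ₙ w ⇔ v′ ≤ₙ w′) → (w ≤ₙ v ⇔ w′ ≤ₙ v′) → (v <ₙ w ⇔ v′ <ₙ w′)
strict-⇔ ≤⇔ ≥⇔ = mk⇔
  (λ (le , ne) → to ≤⇔ le , λ { refl → ne (≤ₙ-antisym le (from ≥⇔ ≤ₙ-refl)) })
  (λ (le , ne) → from ≤⇔ le , λ { refl → ne (≤ₙ-antisym le (to ≥⇔ ≤ₙ-refl)) })
  where
  open Equivalence
  ≤ₙ-refl : ∀ {u} → u ≤ₙ u
  ≤ₙ-refl = Pointwiseₚ.refl ≤-refl

leaves≡suc-internal : ∀ t → leaves t ≡ suc (internal t)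
leaves≡suc-internal leaf       = refl
leaves≡suc-internal (node l r) = begin
  leaves l + leaves r                   ≡⟨ cong₂ _+_ (leaves≡suc-internal l) (leaves≡suc-internal r) ⟩
  suc (internal l) + suc (internal r)   ≡⟨ cong suc (+-suc (internal l) (internal r)) ⟩
  suc (suc (internal l + internal r))   ∎

length-name' : ∀ t → length (name' t) ≡ internal t
length-name' leaf       = refl
length-name' (node l r) = begin
  length (name' l ++ 1 ∷ map (leaves l +_) (name' r))     ≡⟨ length-++ (name' l) ⟩
  length (name' l) + suc (length (map (leaves l +_) (name' r)))
    ≡⟨ cong₂ (λ i j → i + suc j) (length-name' l) (trans (length-map _ (name' r)) (length-name' r)) ⟩
  internal l + suc (internal r)                           ≡⟨ +-suc (internal l) (internal r) ⟩
  suc (internal l + internal r)                           ∎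

name'-positive : ∀ t → All (1 ≤_) (name' t)
name'-positive leaf       = []
name'-positive (node l r) = Allₚ.++⁺ (name'-positive l) (s≤s z≤n ∷ shifted)
  where
  shifted : All (1 ≤_) (map (leaves l +_) (name' r))
  shifted = Allₚ.map⁺ (All.map (λ {v} 1≤v → ≤-trans 1≤v (m≤n+m v (leaves l))) (name'-positive r))

data NodeName : List ℕ → Set where
  1∷_ : ∀ {a} → All (1 ≤_) a → NodeName (1 ∷ a)

NodeName-++ : ∀ {v w} → NodeName v → All (1 ≤_) w → NodeName (v ++ w)
NodeName-++ (1∷ pv) pw = 1∷ Allₚ.++⁺ pv pw

name-node : ∀ l r → NodeName (name (node l r))
name-node leaf         r = 1∷ All.tail (name'-positive (node leaf r))
name-node (node l₁ l₂) r =
  NodeName-++ (name-node l₁ l₂) (Allₚ.++⁻ʳ (name' (node l₁ l₂)) (name'-positive (node (node l₁ l₂) r)))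

ϖ′ : ℕ → Tree → List ℕ → List ℕ
ϖ′ m leaf       a = []
ϖ′ m (node l r) a = ϖ′ m l a ++ map ((internal l * m) ~+_) a ++ map ((suc (internal l) * m) +_) (ϖ′ m r a)

length-ϖ′ : ∀ x a → length (ϖ′ (length a) x a) ≡ internal x * length a
length-ϖ′ leaf       a = refl
length-ϖ′ (node l r) a = begin
  length (ϖ′ m l a ++ map _ a ++ map _ (ϖ′ m r a))
    ≡⟨ length-++ (ϖ′ m l a) ⟩
  length (ϖ′ m l a) + length (map ((internal l * m) ~+_) a ++ map _ (ϖ′ m r a))
    ≡⟨ cong (length (ϖ′ m l a) +_) (length-++ (map ((internal l * m) ~+_) a)) ⟩
  length (ϖ′ m l a) + (length (map ((internal l * m) ~+_) a) + length (map ((suc (internal l) * m) +_) (ϖ′ m r a)))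
    ≡⟨ cong₂ (λ i j → length (ϖ′ m l a) + (i + j)) (length-map _ a) (length-map _ (ϖ′ m r a)) ⟩
  length (ϖ′ m l a) + (m + length (ϖ′ m r a))
    ≡⟨ cong₂ (λ i j → i + (m + j)) (length-ϖ′ l a) (length-ϖ′ r a) ⟩
  internal l * m + (m + internal r * m)
    ≡⟨ blocks (internal l) (internal r) m ⟩
  suc (internal l + internal r) * m ∎
  where
  m : ℕ
  m = length a
  blocks : ∀ i j m → i * m + (m + j * m) ≡ suc (i + j) * m
  blocks = solve-∀

~+-identityˡ : ∀ v → 0 ~+ v ≡ v
~+-identityˡ zero          = refl
~+-identityˡ (suc zero)    = refl
~+-identityˡ (suc (suc v)) = refl

ϖ′-prefix : ∀ m l r a → ∃ λ t → ϖ′ m (node l r) a ≡ a ++ t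
ϖ′-prefix m leaf r a =
  _ , cong (_++ map ((1 * m) +_) (ϖ′ m r a)) (map-id-local (All.universal ~+-identityˡ a))
ϖ′-prefix m (node l₁ l₂) r a with ϖ′-prefix m l₁ l₂ a
... | t , eq = _ , trans (cong (_++ rest) eq) (++-assoc a t rest)
  where
  rest : List ℕ
  rest = map ((internal (node l₁ l₂) * m) ~+_) a ++ map ((suc (internal (node l₁ l₂)) * m) +_) (ϖ′ m r a)

module _ (a′ : List ℕ) where
  private
    a : List ℕ
    a = 1 ∷ a′
    m : ℕ
    m = length a

  ϖ′-block-head : ∀ l k → ∃ λ t → ϖ′ m l a ++ map (k ~+_) a ≡ 1 ∷ t
  ϖ′-block-head leaf         k = _ , refl
  ϖ′-block-head (node l₁ l₂) k with ϖ′-prefix m l₁ l₂ a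
  ... | t , eq = _ , cong (_++ map (k ~+_) a) eq

  ϖ≡ϖ′ : ∀ l r → ϖ (node l r) a ≡ ϖ′ m (node l r) a
  ϖ↗a : ∀ l → ϖ l a ↗ a ≡ ϖ′ m l a ++ map ((internal l * m) ~+_) a
  ↖ϖ : ∀ u r → (1 ∷ u) ↖ ϖ r a ≡ (1 ∷ u) ++ map (length (1 ∷ u) +_) (ϖ′ m r a)

  ϖ↗a leaf = sym (map-id-local (All.universal ~+-identityˡ a))
  ϖ↗a (node l₁ l₂) with ϖ′-prefix m l₁ l₂ a
  ... | t , eq = begin
    ϖ (node l₁ l₂) a ↗ a                       ≡⟨ cong (_↗ a) (trans (ϖ≡ϖ′ l₁ l₂) eq) ⟩
    (a ++ t) ++ map (length (a ++ t) ~+_) a    ≡⟨ cong₂ (λ u k → u ++ map (k ~+_) a) (sym eq) len ⟩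
    ϖ′ m (node l₁ l₂) a ++ map ((internal (node l₁ l₂) * m) ~+_) a ∎
    where
    len : length (a ++ t) ≡ internal (node l₁ l₂) * m
    len = trans (cong length (sym eq)) (length-ϖ′ (node l₁ l₂) a)

  ↖ϖ u leaf         = sym (++-identityʳ (1 ∷ u))
  ↖ϖ u (node r₁ r₂) with ϖ′-prefix m r₁ r₂ a
  ... | t , eq = begin
    (1 ∷ u) ↖ ϖ (node r₁ r₂) a                    ≡⟨ cong ((1 ∷ u) ↖_) (trans (ϖ≡ϖ′ r₁ r₂) eq) ⟩
    (1 ∷ u) ++ map (length (1 ∷ u) +_) (a ++ t)   ≡⟨ cong (λ w → (1 ∷ u) ++ map (length (1 ∷ u) +_) w) (sym eq) ⟩
    (1 ∷ u) ++ map (length (1 ∷ u) +_) (ϖ′ m (node r₁ r₂) a) ∎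

  ϖ≡ϖ′ l r with ϖ′-block-head l (internal l * m)
  ... | t , eq = begin
    (ϖ l a ↗ a) ↖ ϖ r a                             ≡⟨ cong (_↖ ϖ r a) (trans (ϖ↗a l) eq) ⟩
    (1 ∷ t) ↖ ϖ r a                                 ≡⟨ ↖ϖ t r ⟩
    (1 ∷ t) ++ map (length (1 ∷ t) +_) (ϖ′ m r a)   ≡⟨ cong₂ (λ u k → u ++ map (k +_) (ϖ′ m r a)) (sym eq) len ⟩
    (ϖ′ m l a ++ map ((internal l * m) ~+_) a) ++ map ((suc (internal l) * m) +_) (ϖ′ m r a)
                                                     ≡⟨ ++-assoc (ϖ′ m l a) _ _ ⟩
    ϖ′ m (node l r) a                               ∎
    where
    len : length (1 ∷ t) ≡ suc (internal l) * m
    len = begin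
      length (1 ∷ t)                                            ≡⟨ cong length (sym eq) ⟩
      length (ϖ′ m l a ++ map ((internal l * m) ~+_) a)         ≡⟨ length-++ (ϖ′ m l a) ⟩
      length (ϖ′ m l a) + length (map ((internal l * m) ~+_) a) ≡⟨ cong₂ _+_ (length-ϖ′ l a) (length-map _ a) ⟩
      internal l * m + m                                        ≡⟨ +-comm (internal l * m) m ⟩
      suc (internal l) * m                                      ∎

~+-monoʳ-≤ : ∀ c {u v} → 1 ≤ u → u ≤ v → c ~+ u ≤ c ~+ v
~+-monoʳ-≤ c {suc zero}    {suc zero}    _ _       = ≤-refl
~+-monoʳ-≤ c {suc zero}    {suc (suc v)} _ _       = ≤-trans (s≤s z≤n) (m≤n+m (suc (suc v)) c)
~+-monoʳ-≤ c {suc (suc u)} {suc zero}    _ (s≤s ())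
~+-monoʳ-≤ c {suc (suc u)} {suc (suc v)} _ u≤v     = +-monoʳ-≤ c u≤v

map-~+-monoʳ-≤ₙ : ∀ c {a b} → All (1 ≤_) a → a ≤ₙ b → map (c ~+_) a ≤ₙ map (c ~+_) b
map-~+-monoʳ-≤ₙ c []         []         = []
map-~+-monoʳ-≤ₙ c (1≤u ∷ pa) (u≤v ∷ rs) = ~+-monoʳ-≤ c 1≤u u≤v ∷ map-~+-monoʳ-≤ₙ c pa rs

map-+-monoʳ-≤ₙ : ∀ c {a b} → a ≤ₙ b → map (c +_) a ≤ₙ map (c +_) b
map-+-monoʳ-≤ₙ c a≤b = Pointwise.map⁺ (c +_) (c +_) (Pointwise.map (+-monoʳ-≤ c) a≤b)

ϖ′-monoʳ-≤ₙ : ∀ m x {a b} → All (1 ≤_) a → a ≤ₙ b → ϖ′ m x a ≤ₙ ϖ′ m x b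
ϖ′-monoʳ-≤ₙ m leaf       pa a≤b = []
ϖ′-monoʳ-≤ₙ m (node l r) pa a≤b = Pointwise.++⁺ (ϖ′-monoʳ-≤ₙ m l pa a≤b)
  (Pointwise.++⁺ (map-~+-monoʳ-≤ₙ _ pa a≤b) (map-+-monoʳ-≤ₙ _ (ϖ′-monoʳ-≤ₙ m r pa a≤b)))

ϖ′-cancelʳ-≤ₙ : ∀ m l r {a b} → length a ≡ length b → ϖ′ m (node l r) a ≤ₙ ϖ′ m (node l r) b → a ≤ₙ b
ϖ′-cancelʳ-≤ₙ m l r {a} {b} len le with ϖ′-prefix m l r a | ϖ′-prefix m l r b
... | _ , eqa | _ , eqb = proj₁ (Pointwise-++⁻ a b len (subst₂ _≤ₙ_ eqa eqb le))

-- Entry v of a in block k (counted from 0) when the name of x has s in position k + 1: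
-- an entry 1 points to the first position of block s − 1.
blockEntry : ℕ → ℕ → ℕ → ℕ → ℕ
blockEntry m s k (suc zero) = suc (pred s * m)
blockEntry m s k v          = k * m + v

blocksByName : ℕ → List ℕ → List ℕ → ℕ → List ℕ
blocksByName m a []       k = []
blocksByName m a (s ∷ vs) k = map (blockEntry m s k) a ++ blocksByName m a vs (suc k)

blocksByName-++ : ∀ m a vs ws k →
  blocksByName m a (vs ++ ws) k ≡ blocksByName m a vs k ++ blocksByName m a ws (k + length vs)
blocksByName-++ m a []       ws k = cong (blocksByName m a ws) (sym (+-identityʳ k))
blocksByName-++ m a (s ∷ vs) ws k = begin
  map (blockEntry m s k) a ++ blocksByName m a (vs ++ ws) (suc k)
    ≡⟨ cong (map (blockEntry m s k) a ++_) (blocksByName-++ m a vs ws (suc k)) ⟩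
  map (blockEntry m s k) a ++ blocksByName m a vs (suc k) ++ blocksByName m a ws (suc k + length vs)
    ≡⟨ cong (λ i → map (blockEntry m s k) a ++ blocksByName m a vs (suc k) ++ blocksByName m a ws i)
            (sym (+-suc k (length vs))) ⟩
  map (blockEntry m s k) a ++ blocksByName m a vs (suc k) ++ blocksByName m a ws (k + suc (length vs))
    ≡⟨ ++-assoc (map (blockEntry m s k) a) _ _ ⟨
  (map (blockEntry m s k) a ++ blocksByName m a vs (suc k)) ++ blocksByName m a ws (k + suc (length vs)) ∎

[k+p]*m+v≡p*m+[k*m+v] : ∀ k p m v → (k + p) * m + v ≡ p * m + (k * m + v)
[k+p]*m+v≡p*m+[k*m+v] = solve-∀

1+[p+s]*m≡p*m+[1+s*m] : ∀ p s m → suc ((p + s) * m) ≡ p * m + suc (s * m)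
1+[p+s]*m≡p*m+[1+s*m] = solve-∀

blockEntry-shift : ∀ m p s k v → 1 ≤ s → blockEntry m (p + s) (k + p) v ≡ p * m + blockEntry m s k v
blockEntry-shift m p (suc s) k (suc zero) _ = begin
  suc (pred (p + suc s) * m) ≡⟨ cong (λ i → suc (pred i * m)) (+-suc p s) ⟩
  suc ((p + s) * m)          ≡⟨ 1+[p+s]*m≡p*m+[1+s*m] p s m ⟩
  p * m + suc (s * m)        ∎
blockEntry-shift m p s k zero          _ = [k+p]*m+v≡p*m+[k*m+v] k p m 0
blockEntry-shift m p s k (suc (suc v)) _ = [k+p]*m+v≡p*m+[k*m+v] k p m (suc (suc v))

blocksByName-shift : ∀ m a p vs k → All (1 ≤_) vs →
  blocksByName m a (map (p +_) vs) (k + p) ≡ map (p * m +_) (blocksByName m a vs k)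
blocksByName-shift m a p []       k []         = refl
blocksByName-shift m a p (s ∷ vs) k (1≤s ∷ pvs) = begin
  map (blockEntry m (p + s) (k + p)) a ++ blocksByName m a (map (p +_) vs) (suc k + p)
    ≡⟨ cong₂ _++_ (map-∘-cong (λ v → blockEntry-shift m p s k v 1≤s)) (blocksByName-shift m a p vs (suc k) pvs) ⟩
  map (p * m +_) (map (blockEntry m s k) a) ++ map (p * m +_) (blocksByName m a vs (suc k))
    ≡⟨ map-++ (p * m +_) (map (blockEntry m s k) a) _ ⟨
  map (p * m +_) (map (blockEntry m s k) a ++ blocksByName m a vs (suc k)) ∎
  where
  map-∘-cong : ∀ {f g h : ℕ → ℕ} → (∀ v → f v ≡ g (h v)) → map f a ≡ map g (map h a)
  map-∘-cong f≗g∘h = trans (map-cong f≗g∘h a) (map-∘ a)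

blockEntry-1 : ∀ m k v → blockEntry m 1 k v ≡ (k * m) ~+ v
blockEntry-1 m k zero          = refl
blockEntry-1 m k (suc zero)    = refl
blockEntry-1 m k (suc (suc v)) = refl

ϖ′≡blocksByName : ∀ m x a → ϖ′ m x a ≡ blocksByName m a (name' x) 0
ϖ′≡blocksByName m leaf       a = refl
ϖ′≡blocksByName m (node l r) a = sym (begin
  blocksByName m a (name' l ++ 1 ∷ map (leaves l +_) (name' r)) 0
    ≡⟨ blocksByName-++ m a (name' l) _ 0 ⟩
  blocksByName m a (name' l) 0 ++ blocksByName m a (1 ∷ map (leaves l +_) (name' r)) (length (name' l))
    ≡⟨ cong₂ (λ i j → blocksByName m a (name' l) 0 ++ blocksByName m a (1 ∷ map (j +_) (name' r)) i)
             (length-name' l) (leaves≡suc-internal l) ⟩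
  blocksByName m a (name' l) 0 ++ map (blockEntry m 1 (internal l)) a
    ++ blocksByName m a (map (suc (internal l) +_) (name' r)) (suc (internal l))
    ≡⟨ cong₂ (λ u w → u ++ map (blockEntry m 1 (internal l)) a ++ w)
             (sym (ϖ′≡blocksByName m l a)) (blocksByName-shift m a (suc (internal l)) (name' r) 0 (name'-positive r)) ⟩
  ϖ′ m l a ++ map (blockEntry m 1 (internal l)) a ++ map (suc (internal l) * m +_) (blocksByName m a (name' r) 0)
    ≡⟨ cong₂ (λ u w → ϖ′ m l a ++ u ++ map (suc (internal l) * m +_) w)
             (map-cong (blockEntry-1 m (internal l)) a) (sym (ϖ′≡blocksByName m r a)) ⟩
  ϖ′ m (node l r) a ∎)

blockEntry-mono-≤ : ∀ m {s t} k v → s ≤ t → blockEntry m s k v ≤ blockEntry m t k v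
blockEntry-mono-≤ m k zero          s≤t = ≤-refl
blockEntry-mono-≤ m k (suc zero)    s≤t = s≤s (*-monoˡ-≤ m (pred-mono-≤ s≤t))
blockEntry-mono-≤ m k (suc (suc v)) s≤t = ≤-refl

blocksByName-mono-≤ₙ : ∀ m a {vs ws} k → vs ≤ₙ ws → blocksByName m a vs k ≤ₙ blocksByName m a ws k
blocksByName-mono-≤ₙ m a k []           = []
blocksByName-mono-≤ₙ m a k (s≤t ∷ rest) =
  Pointwise.++⁺ (Pointwise.map⁺ _ _ (Pointwiseₚ.refl (λ {v} → blockEntry-mono-≤ m k v s≤t)))
                (blocksByName-mono-≤ₙ m a (suc k) rest)

blocksByName-cancel-≤ₙ : ∀ m a′ {vs ws} k → All (1 ≤_) vs → All (1 ≤_) ws →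
  blocksByName (suc m) (1 ∷ a′) vs k ≤ₙ blocksByName (suc m) (1 ∷ a′) ws k → vs ≤ₙ ws
blocksByName-cancel-≤ₙ m a′ {[]}          {[]}          k _ _ _ = []
blocksByName-cancel-≤ₙ m a′ {suc s ∷ vs}  {suc t ∷ ws}  k (_ ∷ pvs) (_ ∷ pws) (first ∷ rest) =
  s≤s (*-cancelʳ-≤ s t (suc m) (s≤s⁻¹ first))
  ∷ blocksByName-cancel-≤ₙ m a′ (suc k) pvs pws
      (proj₂ (Pointwise-++⁻ _ _ (trans (length-map _ a′) (sym (length-map _ a′))) rest))

⋉̃-≤ₙ-⇔ʳ : ∀ l r {a b} → NodeName a → NodeName b → length a ≡ length b →
          ((node l r ⋉̃ a) ≤ₙ (node l r ⋉̃ b) ⇔ a ≤ₙ b)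
⋉̃-≤ₙ-⇔ʳ l r {1 ∷ a′} {1 ∷ b′} (1∷ pa) (1∷ _) len = mk⇔
  (λ le → ϖ′-cancelʳ-≤ₙ m l r len (subst₂ _≤ₙ_ (ϖ≡ϖ′ a′ l r) ϖb≡ϖ′ le))
  (λ le → subst₂ _≤ₙ_ (sym (ϖ≡ϖ′ a′ l r)) (sym ϖb≡ϖ′) (ϖ′-monoʳ-≤ₙ m (node l r) (s≤s z≤n ∷ pa) le))
  where
  m : ℕ
  m = length (1 ∷ a′)
  ϖb≡ϖ′ : ϖ (node l r) (1 ∷ b′) ≡ ϖ′ m (node l r) (1 ∷ b′)
  ϖb≡ϖ′ = trans (ϖ≡ϖ′ b′ l r) (cong (λ k → ϖ′ k (node l r) (1 ∷ b′)) (sym len))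

⋉̃-≤ₙ-⇔ˡ : ∀ xl xr yl yr {a} → NodeName a →
          ((node xl xr ⋉̃ a) ≤ₙ (node yl yr ⋉̃ a) ⇔ name (node xl xr) ≤ₙ name (node yl yr))
⋉̃-≤ₙ-⇔ˡ xl xr yl yr {1 ∷ a′} (1∷ _) = mk⇔
  (λ le → blocksByName-cancel-≤ₙ (length a′) a′ 0 (name'-positive (node xl xr)) (name'-positive (node yl yr))
            (subst₂ _≤ₙ_ (ϖ≡blocksByName xl xr) (ϖ≡blocksByName yl yr) le))
  (λ le → subst₂ _≤ₙ_ (sym (ϖ≡blocksByName xl xr)) (sym (ϖ≡blocksByName yl yr))
            (blocksByName-mono-≤ₙ m (1 ∷ a′) 0 le))
  where
  m : ℕ
  m = length (1 ∷ a′)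
  ϖ≡blocksByName : ∀ l r → ϖ (node l r) (1 ∷ a′) ≡ blocksByName m (1 ∷ a′) (name' (node l r)) 0
  ϖ≡blocksByName l r = trans (ϖ≡ϖ′ a′ l r) (ϖ′≡blocksByName m (node l r) (1 ∷ a′))

proposition3p4 : (n m : ℕ) → 1 ≤ n → 1 ≤ m →
    (x y : Tree) → internal x ≡ n → internal y ≡ n →
    (a b : Tree) → internal a ≡ m → internal b ≡ m →
    ((x ⋉̃ name a) <ₙ (x ⋉̃ name b) ⇔ name a <ₙ name b)
    × ((x ⋉̃ name a) <ₙ (y ⋉̃ name a) ⇔ name x <ₙ name y)
proposition3p4 _ _ () _ leaf _ refl _ _ _ _ _
proposition3p4 _ _ () _ (node _ _) leaf _ refl _ _ _ _
proposition3p4 _ _ _ () (node _ _) (node _ _) _ _ leaf _ refl _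
proposition3p4 _ _ _ () (node _ _) (node _ _) _ _ (node _ _) leaf _ refl
-- x and y need not have the same size: ≤ₙ already forces equal lengths.
proposition3p4 _ _ _ _ (node xl xr) (node yl yr) _ _ a@(node al ar) b@(node bl br) ia ib =
    strict-⇔ (⋉̃-≤ₙ-⇔ʳ xl xr A B len) (⋉̃-≤ₙ-⇔ʳ xl xr B A (sym len))
  , strict-⇔ (⋉̃-≤ₙ-⇔ˡ xl xr yl yr A) (⋉̃-≤ₙ-⇔ˡ yl yr xl xr A)
  where
  A : NodeName (name a)
  A = name-node al ar
  B : NodeName (name b)
  B = name-node bl br
  len : length (name a) ≡ length (name b)
  len = trans (length-name' a) (trans ia (sym (trans (length-name' b) ib)))
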